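{- The class of nested matroids is well-quasi-ordered under the minor order (with isomorphic matroids identified); that is, there is no infinite set of nested matroids none of which is isomorphic to a minor of another.
   Context: A nested matroid is a matroid that can be obtained from the empty matroid by iterating the operations of adding an isthmus (coloop) and taking a free extension. The free extension $M+e$ ($e\notin E(M)$) is the matroid on $E(M)\cup e$ whose circuits are those of $M$ together with the sets $B\cup e$ for bases $B$ of $M$. -}

module Defs where

open import Level using (Level; suc; zero)
open import Data.Nat as ℕ using (ℕ; _<_)
import Data.Nat
open import Data.Fin using (Fin)
import Data.Fin as F
open import Data.Fin.Subset
  using (Subset; ⊥; ⊤; ⁅_⁆; _∈_; _∉_; _⊆_; _⊂_; _∪_; ∣_∣; inside; outside)
open import Data.Vec using ([]; _∷_)
open import Data.Bool using (true; false)
open import Data.Product using (Σ; Σ-syntax; ∃; ∃-syntax; _×_; _,_)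
open import Data.Unit.Polymorphic using () renaming (⊤ to ⊤ℓ)
open import Relation.Nullary using (¬_)
open import Relation.Binary.PropositionalEquality using (_≡_)
open import Function.Bundles using (_⇔_)
open import Function.Definitions using (Injective; Bijective)

Pred₀ : ℕ → Set₁
Pred₀ n = Subset n → Set

IsBasisOf : ∀ {n} → Pred₀ n → Subset n → Subset n → Set
IsBasisOf I C B = B ⊆ C × I B × (∀ Y → B ⊆ Y → Y ⊆ C → I Y → Y ≡ B)

IsBasis : ∀ {n} → Pred₀ n → Subset n → Set
IsBasis I B = IsBasisOf I ⊤ B

IsCircuit : ∀ {n} → Pred₀ n → Subset n → Set
IsCircuit I C = ¬ I C × (∀ Y → Y ⊂ C → I Y)

record Matroid (n : ℕ) : Set₁ where
  field
    Indep       : Subset n → Set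
    indep-∅     : Indep ⊥
    hereditary  : ∀ X Y → X ⊆ Y → Indep Y → Indep X
    augment     : ∀ X Y → Indep X → Indep Y → ∣ X ∣ < ∣ Y ∣ →
                  ∃[ y ] (y ∈ Y × y ∉ X × Indep (X ∪ ⁅ y ⁆))
open Matroid public

image : ∀ {m n} → (Fin m → Fin n) → Subset m → Subset n
image {ℕ.zero}  φ []            = ⊥
image {ℕ.suc m} φ (true  ∷ X)   = ⁅ φ F.zero ⁆ ∪ image (λ i → φ (F.suc i)) X
image {ℕ.suc m} φ (false ∷ X)   = image (λ i → φ (F.suc i)) X

_≅_ : ∀ {m n} → Pred₀ m → Pred₀ n → Set
_≅_ {m} {n} I J =
  Σ[ φ ∈ (Fin m → Fin n) ] Bijective _≡_ _≡_ φ × (∀ X → I X ⇔ J (image φ X))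

-- Independent sets of the contraction M / C (on E − C):
-- Y is independent in M/C iff Y ∪ B is independent in M for a basis B of M|C.
IndepContr : ∀ {n} → Matroid n → Subset n → Subset n → Set
IndepContr M C Y = Σ[ B ∈ Subset _ ] (IsBasisOf (Indep M) C B × Indep M (Y ∪ B))

-- N is isomorphic to a minor M / C \ D of M:  the ground set of N is
-- embedded by φ into E(M) − C (D is the complement of C ∪ im φ), and
-- independence in N corresponds to independence in M / C.
_≼_ : ∀ {m n} → Matroid m → Matroid n → Set
_≼_ {m} {n} N M =
  Σ[ φ ∈ (Fin m → Fin n) ] Injective _≡_ _≡_ φ ×
  Σ[ C ∈ Subset n ] ((∀ x → φ x ∉ C) ×
     (∀ X → Indep N X ⇔ IndepContr M C (image φ X)))

-- Circuits of the free extension M + e, where e is the new element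
-- F.zero: circuits of M, together with B ∪ e for bases B of M.
FreeExtCircuit : ∀ {n} → Pred₀ n → Pred₀ (ℕ.suc n)
FreeExtCircuit I (true  ∷ X) = IsBasis I X
FreeExtCircuit I (false ∷ X) = IsCircuit I X

-- Construction sequences: start with the empty matroid, and repeatedly
-- add an isthmus or take a free extension (new element = F.zero).
data NestedExpr : ℕ → Set where
  empty    : NestedExpr 0
  isthmus  : ∀ {n} → NestedExpr n → NestedExpr (ℕ.suc n)
  freeExt  : ∀ {n} → NestedExpr n → NestedExpr (ℕ.suc n)

⟦_⟧ : ∀ {n} → NestedExpr n → Pred₀ n
⟦ empty     ⟧ X       = ⊤ℓ
⟦ isthmus e ⟧ (_ ∷ X) = ⟦ e ⟧ X
⟦ freeExt e ⟧ X       = ∀ Y → Y ⊆ X → ¬ FreeExtCircuit ⟦ e ⟧ Y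

Nested : ∀ {n} → Matroid n → Set
Nested {n} M = Σ[ e ∈ NestedExpr n ] (Indep M ≅ ⟦ e ⟧)

NestedMatroid : Set₁
NestedMatroid = Σ[ n ∈ ℕ ] Σ[ M ∈ Matroid n ] Nested M

_≼ⁿ_ : NestedMatroid → NestedMatroid → Set
(_ , M , _) ≼ⁿ (_ , N , _) = M ≼ N

-- A construction sequence of a nested matroid is a word over {isthmus, free extension}, and
-- independence can be read off the word: in M + e a set X ∪ e is independent iff X is
-- independent in M and ∣X∣ < r(M), since adding e to a basis is exactly what creates a circuit.
-- If the word of N is a subsequence of the word of M, then N is the minor of M obtained by
-- contracting the isthmuses and deleting the free-extension elements skipped by the embedding:
-- every contracted isthmus raises both the rank and the size of every set by one, so the
-- condition ∣X∣ < r survives at the matched free-extension elements.  Higman's lemma for binary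
-- words then finds, in every sequence of nested matroids, an earlier word embedded in a later one.
module Submission where

open import Defs
open import Data.Bool using (Bool; true; false; not; _≟_)
open import Data.Bool.Properties using (¬-not; ∨-identityʳ)
open import Data.Empty using (⊥-elim)
open import Data.Fin using (Fin; zero; suc; lift)
open import Data.Fin.Properties using (suc-injective; lift-injective)
open import Data.Fin.Subset using (Subset; ⊥; _∈_; _∉_; _⊆_; _⊂_; _∪_; ⁅_⁆; ∣_∣; inside; outside)
open import Data.Fin.Subset.Properties
  using (_∈?_; drop-there; drop-∷-⊆; drop-∷-⊂; out⊆; s⊆s; s⊂s; out⊂in; ⊆-refl; ⊆-antisym; ⊆⊤;
         p⊆q⇒∣p∣≤∣q∣; p⊂q⇒∣p∣<∣q∣; ⊂-irref; x∈p∪q⁺; x∈p∪q⁻; x∈⁅x⁆; x∈⁅y⁆⇒x≡y; ∉⊥; ∪-identityˡ)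
open import Data.List using (List; []; _∷_; map; applyDownFrom)
open import Data.List.Relation.Binary.Sublist.Heterogeneous using ([]; _∷_; _∷ʳ_; minimum)
open import Data.List.Relation.Binary.Sublist.Propositional using () renaming (_⊆_ to _⊑_)
open import Data.List.Relation.Unary.Any as Any using (Any; here; there)
open import Data.List.Relation.Unary.Any.Properties using (map⁺; applyDownFrom⁻)
open import Data.Nat using (ℕ; suc; _+_; _≤_; _<_; z≤n; s≤s; _<?_)
open import Data.Nat.Properties
  using (<-irrefl; ≤-<-trans; ≤-antisym; ≤⇒≯; ≮⇒≥; m≤n⇒m≤1+n; +-suc; +-monoˡ-<; +-cancelʳ-<)
open import Data.Product using (_×_; _,_; proj₁; proj₂; ∃-syntax)
open import Data.Product.Function.NonDependent.Propositional using (_×-⇔_)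
open import Data.Sum using (inj₁; inj₂; [_,_]′)
open import Data.Unit using (⊤; tt)
open import Data.Vec using ([]; _∷_; here; there)
open import Function using (_∘_; id)
open import Function.Bundles using (_⇔_; mk⇔; Equivalence)
open import Function.Definitions using (Injective)
open import Function.Properties.Equivalence using ()
  renaming (refl to ⇔-refl; sym to ⇔-sym; trans to ⇔-trans)
import Function.Related.Propositional as Related
open import Relation.Nullary using (¬_; yes; no; contradiction)
open import Relation.Nullary.Decidable using (_×-dec_; decidable-stable)
open import Relation.Unary using (Decidable)
open import Relation.Binary.PropositionalEquality
  using (_≡_; refl; sym; trans; cong; cong₂; subst; module ≡-Reasoning)

-- Higman's lemma for binary words

Word : Set
Word = List Bool

-- Finite sequences of words are lists with the newest word first.
data Good : List Word → Set where
  good-here  : ∀ {w ws} → Any (_⊑ w) ws → Good (w ∷ ws)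
  good-there : ∀ {w ws} → Good ws → Good (w ∷ ws)

data Bar : List Word → Set where
  now   : ∀ {ws} → Good ws → Bar ws
  later : ∀ {ws} → (∀ w → Bar (w ∷ ws)) → Bar ws

bar-[]∷ : ∀ {ws} → Bar ([] ∷ ws)
bar-[]∷ = later λ w → now (good-here (here (minimum w)))

Good-map-∷ : ∀ {a ws} → Good ws → Good (map (a ∷_) ws)
Good-map-∷ (good-here p)  = good-here (map⁺ (Any.map (refl ∷_) p))
Good-map-∷ (good-there g) = good-there (Good-map-∷ g)

-- Tails a vs zs (Coquand–Fridlender): zs = zs₁ ++ (a ∷ w) ∷ zs₀ and vs is w ∷ zs₀ preceded by
-- the tails of some words a ∷ u of zs₁.
data Tails (a : Bool) : List Word → List Word → Set where
  start : ∀ {w zs} → Tails a (w ∷ zs) ((a ∷ w) ∷ zs)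
  keep  : ∀ {w vs zs} → Tails a vs zs → Tails a (w ∷ vs) ((a ∷ w) ∷ zs)
  skip  : ∀ {b w vs zs} → Tails a vs zs → Tails a vs ((b ∷ w) ∷ zs)

Any-tails : ∀ {a vs zs v} → Tails a vs zs → Any (_⊑ v) vs → Any (_⊑ a ∷ v) zs
Any-tails start    (here p)  = here (refl ∷ p)
Any-tails start    (there p) = there (Any.map (_ ∷ʳ_) p)
Any-tails (keep t) (here p)  = here (refl ∷ p)
Any-tails (keep t) (there p) = there (Any-tails t p)
Any-tails (skip t) p         = there (Any-tails t p)

Good-tails : ∀ {a vs zs} → Tails a vs zs → Good vs → Good zs
Good-tails start    (good-here p)  = good-here (Any.map (_ ∷ʳ_) p)
Good-tails start    (good-there g) = good-there g
Good-tails (keep t) (good-here p)  = good-here (Any-tails t p)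
Good-tails (keep t) (good-there g) = good-there (Good-tails t g)
Good-tails (skip t) g              = good-there (Good-tails t g)

tails-map-∷ : ∀ {a} x xs → Tails a (x ∷ xs) (map (a ∷_) (x ∷ xs))
tails-map-∷ x []       = start
tails-map-∷ x (y ∷ ys) = keep (tails-map-∷ y ys)

-- Lexicographic induction on the two bars: a new word a ∷ u advances the first,
-- a word (not a) ∷ u the second.
bar-tails   : ∀ {a xs ys zs} → Bar xs → Bar ys → Tails a xs zs → Tails (not a) ys zs → Bar zs
bar-tails-∷ : ∀ {a xs ys zs} → Bar xs → Bar ys → Tails a xs zs → Tails (not a) ys zs →
              ∀ w → Bar (w ∷ zs)

bar-tails (now g)      _            ta _  = now (Good-tails ta g)
bar-tails (later _)    (now g)      _  tb = now (Good-tails tb g)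
bar-tails bx@(later _) by@(later _) ta tb = later (bar-tails-∷ bx by ta tb)

bar-tails-∷ _ _ _ _ [] = bar-[]∷
bar-tails-∷ {a} bx by ta tb (c ∷ cs) with c ≟ a
bar-tails-∷ (now g)    _  ta _  (c ∷ cs) | yes refl = now (good-there (Good-tails ta g))
bar-tails-∷ (later fx) by ta tb (c ∷ cs) | yes refl = bar-tails (fx cs) by (keep ta) (skip tb)
bar-tails-∷ _ (now g)    _  tb (c ∷ cs) | no _ = now (good-there (Good-tails tb g))
bar-tails-∷ bx (later fy) ta tb (c ∷ cs) | no c≢a with ¬-not c≢a
... | refl = bar-tails bx (fy cs) (skip ta) (keep tb)

bar-map-∷ : ∀ {a x xs} → Bar (x ∷ xs) → Bar (map (a ∷_) (x ∷ xs))
bar-map-∷ (now g) = now (Good-map-∷ g)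
bar-map-∷ {a} {x} {xs} bx@(later f) = later next
  where
  next : ∀ w → Bar (w ∷ map (a ∷_) (x ∷ xs))
  next []       = bar-[]∷
  next (c ∷ cs) with c ≟ a
  ... | yes refl = bar-map-∷ (f cs)
  ... | no c≢a with ¬-not c≢a
  ...   | refl = bar-tails bx (next cs) (skip (tails-map-∷ x xs)) start

bar-[_] : ∀ w → Bar (w ∷ [])
bar-[ [] ]     = bar-[]∷
bar-[ c ∷ cs ] = bar-map-∷ bar-[ cs ]

bar-[] : Bar []
bar-[] = later bar-[_]

module _ (f : ℕ → Word) where

  Good-applyDownFrom : ∀ n → Good (applyDownFrom f n) → ∃[ i ] ∃[ j ] (i < j × f i ⊑ f j)
  Good-applyDownFrom (suc n) (good-here p)  =
    let i , i<n , q = applyDownFrom⁻ f p in i , n , i<n , q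
  Good-applyDownFrom (suc n) (good-there g) = Good-applyDownFrom n g

  Bar-applyDownFrom : ∀ n → Bar (applyDownFrom f n) → ∃[ i ] ∃[ j ] (i < j × f i ⊑ f j)
  Bar-applyDownFrom n (now g)   = Good-applyDownFrom n g
  Bar-applyDownFrom n (later h) = Bar-applyDownFrom (suc n) (h (f n))

higman : (f : ℕ → Word) → ∃[ i ] ∃[ j ] (i < j × f i ⊑ f j)
higman f = Bar-applyDownFrom f 0 bar-[]

⊆∧∣∣≤⇒≡ : ∀ {n} {X Y : Subset n} → X ⊆ Y → ∣ Y ∣ ≤ ∣ X ∣ → Y ≡ X
⊆∧∣∣≤⇒≡ {X = X} {Y} X⊆Y ∣Y∣≤∣X∣ = ⊆-antisym Y⊆X X⊆Y
  where
  Y⊆X : Y ⊆ X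
  Y⊆X {x} x∈Y with x ∈? X
  ... | yes x∈X = x∈X
  ... | no  x∉X = contradiction (p⊂q⇒∣p∣<∣q∣ (X⊆Y , x , x∈Y , x∉X)) (≤⇒≯ ∣Y∣≤∣X∣)

∈-image⁺ : ∀ {m n} (f : Fin m → Fin n) {X x} → x ∈ X → f x ∈ image f X
∈-image⁺ f {inside ∷ X}  here        = x∈p∪q⁺ (inj₁ (x∈⁅x⁆ (f zero)))
∈-image⁺ f {inside ∷ X}  (there x∈X) = x∈p∪q⁺ (inj₂ (∈-image⁺ (f ∘ suc) x∈X))
∈-image⁺ f {outside ∷ X} (there x∈X) = ∈-image⁺ (f ∘ suc) x∈X

∈-image⁻ : ∀ {m n} (f : Fin m → Fin n) {X y} → y ∈ image f X → ∃[ x ] (x ∈ X × f x ≡ y)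
∈-image⁻ f {[]} y∈ = ⊥-elim (∉⊥ y∈)
∈-image⁻ f {inside ∷ X} y∈ with x∈p∪q⁻ ⁅ f zero ⁆ (image (f ∘ suc) X) y∈
... | inj₁ y∈⁅f0⁆ = zero , here , sym (x∈⁅y⁆⇒x≡y (f zero) y∈⁅f0⁆)
... | inj₂ y∈img  = let x , x∈X , fx≡y = ∈-image⁻ (f ∘ suc) y∈img in suc x , there x∈X , fx≡y
∈-image⁻ f {outside ∷ X} y∈ = let x , x∈X , fx≡y = ∈-image⁻ (f ∘ suc) y∈ in suc x , there x∈X , fx≡y

image-⊆ : ∀ {m n} {f : Fin m → Fin n} {X Z} → (∀ {x} → x ∈ X → f x ∈ Z) → image f X ⊆ Z
image-⊆ {f = f} f[X]⊆Z y∈ = let x , x∈X , fx≡y = ∈-image⁻ f y∈ in subst (_∈ _) fx≡y (f[X]⊆Z x∈X)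

image-id : ∀ {n} (X : Subset n) → image id X ≡ X
image-id X = ⊆-antisym (image-⊆ id) (∈-image⁺ id)

image-∘ : ∀ {l m n} (g : Fin m → Fin n) (f : Fin l → Fin m) X →
          image (g ∘ f) X ≡ image g (image f X)
image-∘ g f X = ⊆-antisym (image-⊆ (∈-image⁺ g ∘ ∈-image⁺ f)) (image-⊆ g[f[X]]⊆gf[X])
  where
  g[f[X]]⊆gf[X] : ∀ {z} → z ∈ image f X → g z ∈ image (g ∘ f) X
  g[f[X]]⊆gf[X] z∈ =
    let x , x∈X , fx≡z = ∈-image⁻ f z∈ in subst (λ z → g z ∈ _) fx≡z (∈-image⁺ (g ∘ f) x∈X)

image-∪ : ∀ {m n} (f : Fin m → Fin n) X Y → image f (X ∪ Y) ≡ image f X ∪ image f Y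
image-∪ f X Y = ⊆-antisym
  (image-⊆ (x∈p∪q⁺ ∘ [ inj₁ ∘ ∈-image⁺ f , inj₂ ∘ ∈-image⁺ f ]′ ∘ x∈p∪q⁻ X Y))
  ([ image-⊆ (∈-image⁺ f ∘ x∈p∪q⁺ ∘ inj₁) , image-⊆ (∈-image⁺ f ∘ x∈p∪q⁺ ∘ inj₂) ]′ ∘ x∈p∪q⁻ _ _)

image-cong : ∀ {m n} {f g : Fin m → Fin n} → (∀ x → f x ≡ g x) → ∀ X → image f X ≡ image g X
image-cong f≗g []            = refl
image-cong f≗g (inside ∷ X)  = cong₂ _∪_ (cong ⁅_⁆ (f≗g zero)) (image-cong (f≗g ∘ suc) X)
image-cong f≗g (outside ∷ X) = image-cong (f≗g ∘ suc) X

image-suc : ∀ {m n} (f : Fin m → Fin n) X → image (suc ∘ f) X ≡ outside ∷ image f X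
image-suc f []            = refl
image-suc f (inside ∷ X)  = cong (⁅ suc (f zero) ⁆ ∪_) (image-suc (f ∘ suc) X)
image-suc f (outside ∷ X) = image-suc (f ∘ suc) X

image-lift : ∀ {m n} (f : Fin m → Fin n) b X → image (lift 1 f) (b ∷ X) ≡ b ∷ image f X
image-lift f inside  X =
  trans (cong (⁅ zero ⁆ ∪_) (image-suc f X)) (cong (inside ∷_) (∪-identityˡ _))
image-lift f outside X = image-suc f X

image-suc-∪ : ∀ {m n} (f : Fin m → Fin n) b X C → image (suc ∘ f) X ∪ (b ∷ C) ≡ b ∷ (image f X ∪ C)
image-suc-∪ f b X C = cong (_∪ (b ∷ C)) (image-suc f X)

image-lift-∪ : ∀ {m n} (f : Fin m → Fin n) b X C →
               image (lift 1 f) (b ∷ X) ∪ (outside ∷ C) ≡ b ∷ (image f X ∪ C)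
image-lift-∪ f b X C =
  trans (cong (_∪ (outside ∷ C)) (image-lift f b X)) (cong (_∷ _) (∨-identityʳ b))

Hereditary : ∀ {n} → Pred₀ n → Set
Hereditary I = ∀ {X Y} → X ⊆ Y → I Y → I X

module _ {n} {I : Pred₀ (suc n)} where

  outside-circuit : ∀ {C} → IsCircuit (λ Y → I (outside ∷ Y)) C → IsCircuit I (outside ∷ C)
  outside-circuit (¬iC , minimal) = ¬iC , λ
    { (outside ∷ Y) Y⊂C → minimal Y (drop-∷-⊂ Y⊂C)
    ; (inside ∷ Y)  Y⊂C → contradiction (proj₁ Y⊂C here) λ () }

  inside-circuit : Hereditary I → ∀ {C} → I (outside ∷ C) →
                   IsCircuit (λ Y → I (inside ∷ Y)) C → IsCircuit I (inside ∷ C)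
  inside-circuit hereditary iC₀ (¬iC , minimal) = ¬iC , λ
    { (outside ∷ Y) Y⊂C → hereditary (out⊆ (drop-∷-⊆ (proj₁ Y⊂C))) iC₀
    ; (inside ∷ Y)  Y⊂C → minimal Y (drop-∷-⊂ Y⊂C) }

dependent⇒circuit : ∀ {n} {I : Pred₀ n} → Decidable I → Hereditary I →
                    ∀ X → ¬ I X → ∃[ C ] (C ⊆ X × IsCircuit I C)
dependent⇒circuit I? hereditary [] ¬iX = [] , ⊆-refl , ¬iX , λ { _ (_ , () , _) }
dependent⇒circuit I? hereditary (b ∷ X) ¬iX with I? (outside ∷ X) | b
... | no ¬iX₀ | _ =
  let C , C⊆X , circuit = dependent⇒circuit (I? ∘ (outside ∷_)) (hereditary ∘ s⊆s) X ¬iX₀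
  in outside ∷ C , out⊆ C⊆X , outside-circuit circuit
... | yes iX₀ | outside = contradiction iX₀ ¬iX
... | yes iX₀ | inside =
  let C , C⊆X , circuit = dependent⇒circuit (I? ∘ (inside ∷_)) (hereditary ∘ s⊆s) X ¬iX
  in inside ∷ C , s⊆s C⊆X , inside-circuit hereditary (hereditary (out⊆ C⊆X) iX₀) circuit

module _ {n} {I J : Pred₀ n} (I⇔J : ∀ X → I X ⇔ J X) where

  IsCircuit-cong : ∀ {C} → IsCircuit I C → IsCircuit J C
  IsCircuit-cong (¬iC , minimal) =
    ¬iC ∘ Equivalence.from (I⇔J _) , λ Y Y⊂C → Equivalence.to (I⇔J Y) (minimal Y Y⊂C)

  IsBasis-cong : ∀ {B} → IsBasis I B → IsBasis J B
  IsBasis-cong (B⊆⊤ , iB , maximal) =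
    B⊆⊤ , Equivalence.to (I⇔J _) iB ,
    λ Y B⊆Y Y⊆⊤ jY → maximal Y B⊆Y Y⊆⊤ (Equivalence.from (I⇔J Y) jY)

  FreeExtCircuit-cong : ∀ {C} → FreeExtCircuit I C → FreeExtCircuit J C
  FreeExtCircuit-cong {inside ∷ C}  = IsBasis-cong
  FreeExtCircuit-cong {outside ∷ C} = IsCircuit-cong

FreeExtIndependent : ∀ {n} → Pred₀ n → Pred₀ (suc n)
FreeExtIndependent I X = ∀ C → C ⊆ X → ¬ FreeExtCircuit I C

FreeExtIndependent-cong : ∀ {n} {I J : Pred₀ n} → (∀ X → I X ⇔ J X) →
                          ∀ X → FreeExtIndependent I X ⇔ FreeExtIndependent J X
FreeExtIndependent-cong I⇔J X = mk⇔
  (λ indep C C⊆X → indep C C⊆X ∘ FreeExtCircuit-cong (⇔-sym ∘ I⇔J))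
  (λ indep C C⊆X → indep C C⊆X ∘ FreeExtCircuit-cong I⇔J)

rank : ∀ {n} → NestedExpr n → ℕ
rank empty       = 0
rank (isthmus e) = suc (rank e)
rank (freeExt e) = rank e

Independent : ∀ {n} → NestedExpr n → Pred₀ n
Independent empty       []            = ⊤
Independent (isthmus e) (_ ∷ X)       = Independent e X
Independent (freeExt e) (outside ∷ X) = Independent e X
Independent (freeExt e) (inside ∷ X)  = Independent e X × ∣ X ∣ < rank e

independent? : ∀ {n} (e : NestedExpr n) → Decidable (Independent e)
independent? empty       []            = yes tt
independent? (isthmus e) (_ ∷ X)       = independent? e X
independent? (freeExt e) (outside ∷ X) = independent? e X
independent? (freeExt e) (inside ∷ X)  = independent? e X ×-dec (∣ X ∣ <? rank e)

Independent-hereditary : ∀ {n} (e : NestedExpr n) → Hereditary (Independent e)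
Independent-hereditary empty {[]} {[]} _ _ = tt
Independent-hereditary (isthmus e) {_ ∷ X} {_ ∷ Y} X⊆Y = Independent-hereditary e (drop-∷-⊆ X⊆Y)
Independent-hereditary (freeExt e) {outside ∷ X} {outside ∷ Y} X⊆Y =
  Independent-hereditary e (drop-∷-⊆ X⊆Y)
Independent-hereditary (freeExt e) {outside ∷ X} {inside ∷ Y} X⊆Y (iY , _) =
  Independent-hereditary e (drop-∷-⊆ X⊆Y) iY
Independent-hereditary (freeExt e) {inside ∷ X} {outside ∷ Y} X⊆Y with X⊆Y here
... | ()
Independent-hereditary (freeExt e) {inside ∷ X} {inside ∷ Y} X⊆Y (iY , ∣Y∣<r) =
  Independent-hereditary e (drop-∷-⊆ X⊆Y) iY , ≤-<-trans (p⊆q⇒∣p∣≤∣q∣ (drop-∷-⊆ X⊆Y)) ∣Y∣<r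

∣∣≤rank : ∀ {n} (e : NestedExpr n) {X} → Independent e X → ∣ X ∣ ≤ rank e
∣∣≤rank empty       {[]}          _        = z≤n
∣∣≤rank (isthmus e) {inside ∷ X}  iX       = s≤s (∣∣≤rank e iX)
∣∣≤rank (isthmus e) {outside ∷ X} iX       = m≤n⇒m≤1+n (∣∣≤rank e iX)
∣∣≤rank (freeExt e) {outside ∷ X} iX       = ∣∣≤rank e iX
∣∣≤rank (freeExt e) {inside ∷ X}  (_ , lt) = lt

extend : ∀ {n} (e : NestedExpr n) {X} → Independent e X → ∣ X ∣ < rank e →
         ∃[ Y ] (X ⊂ Y × ∣ Y ∣ ≡ suc ∣ X ∣ × Independent e Y)
extend (isthmus e) {outside ∷ X} iX _ = inside ∷ X , out⊂in ⊆-refl , refl , iX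
extend (isthmus e) {inside ∷ X}  iX (s≤s lt) =
  let Y , X⊂Y , ∣Y∣≡ , iY = extend e iX lt in inside ∷ Y , s⊂s X⊂Y , cong suc ∣Y∣≡ , iY
extend (freeExt e) {outside ∷ X} iX lt = inside ∷ X , out⊂in ⊆-refl , refl , iX , lt
extend (freeExt e) {inside ∷ X}  (iX , lt) suc∣X∣<r =
  let Y , X⊂Y , ∣Y∣≡ , iY = extend e iX lt
  in inside ∷ Y , s⊂s X⊂Y , cong suc ∣Y∣≡ , iY , subst (_< rank e) (sym ∣Y∣≡) suc∣X∣<r

IsBasis⇔full-rank : ∀ {n} (e : NestedExpr n) {B} →
                    IsBasis (Independent e) B ⇔ (Independent e B × ∣ B ∣ ≡ rank e)
IsBasis⇔full-rank e {B} = mk⇔ to from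
  where
  to : IsBasis (Independent e) B → Independent e B × ∣ B ∣ ≡ rank e
  to (_ , iB , maximal) = iB , ≤-antisym (∣∣≤rank e iB) (≮⇒≥ not-extendable)
    where
    not-extendable : ¬ ∣ B ∣ < rank e
    not-extendable lt =
      let Y , B⊂Y , _ , iY = extend e iB lt in ⊂-irref (sym (maximal Y (proj₁ B⊂Y) ⊆⊤ iY)) B⊂Y
  from : Independent e B × ∣ B ∣ ≡ rank e → IsBasis (Independent e) B
  from (iB , ∣B∣≡r) =
    ⊆⊤ , iB , λ Y B⊆Y _ iY → ⊆∧∣∣≤⇒≡ B⊆Y (subst (∣ Y ∣ ≤_) (sym ∣B∣≡r) (∣∣≤rank e iY))

module _ {n} (e : NestedExpr n) where

  no-circuit⇒Independent : ∀ {X} → (∀ C → C ⊆ X → ¬ IsCircuit (Independent e) C) → Independent e X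
  no-circuit⇒Independent {X} no-circuit with independent? e X
  ... | yes iX = iX
  ... | no ¬iX =
    let C , C⊆X , circuit = dependent⇒circuit (independent? e) (Independent-hereditary e) X ¬iX
    in ⊥-elim (no-circuit C C⊆X circuit)

  FreeExtIndependent-tail : ∀ {b X} → FreeExtIndependent (Independent e) (b ∷ X) → Independent e X
  FreeExtIndependent-tail indep = no-circuit⇒Independent λ C C⊆X → indep (outside ∷ C) (out⊆ C⊆X)

  FreeExtIndependent⇒Independent : ∀ X → FreeExtIndependent (Independent e) X →
                                   Independent (freeExt e) X
  FreeExtIndependent⇒Independent (outside ∷ X) indep = FreeExtIndependent-tail indep
  FreeExtIndependent⇒Independent (inside ∷ X)  indep =
    iX , decidable-stable (∣ X ∣ <? rank e) X-not-basis
    where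
    iX : Independent e X
    iX = FreeExtIndependent-tail indep
    X-not-basis : ¬ ¬ ∣ X ∣ < rank e
    X-not-basis ¬lt = indep (inside ∷ X) ⊆-refl
      (Equivalence.from (IsBasis⇔full-rank e) (iX , ≤-antisym (∣∣≤rank e iX) (≮⇒≥ ¬lt)))

  Independent⇒FreeExtIndependent : ∀ X → Independent (freeExt e) X →
                                   FreeExtIndependent (Independent e) X
  Independent⇒FreeExtIndependent X iX (outside ∷ C) C⊆X (¬iC , _) =
    ¬iC (Independent-hereditary (freeExt e) C⊆X iX)
  Independent⇒FreeExtIndependent X iX (inside ∷ C)  C⊆X basis =
    <-irrefl (proj₂ (Equivalence.to (IsBasis⇔full-rank e) basis))
             (proj₂ (Independent-hereditary (freeExt e) C⊆X iX))

⟦⟧⇔Independent : ∀ {n} (e : NestedExpr n) X → ⟦ e ⟧ X ⇔ Independent e X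
⟦⟧⇔Independent empty       []      = mk⇔ _ _
⟦⟧⇔Independent (isthmus e) (_ ∷ X) = ⟦⟧⇔Independent e X
⟦⟧⇔Independent (freeExt e) X       = ⇔-trans
  (FreeExtIndependent-cong (⟦⟧⇔Independent e) X)
  (mk⇔ (FreeExtIndependent⇒Independent e X) (Independent⇒FreeExtIndependent e X))

record _↪_ {m n} (I : Pred₀ m) (J : Pred₀ n) : Set where
  constructor embedding
  field
    function  : Fin m → Fin n
    injective : Injective _≡_ _≡_ function
    preserves : ∀ X → I X ⇔ J (image function X)

≅⇒↪ : ∀ {m n} {I : Pred₀ m} {J : Pred₀ n} → I ≅ J → I ↪ J
≅⇒↪ (φ , (φ-injective , _) , I⇔J) = embedding φ φ-injective I⇔J

≅⇒↩ : ∀ {m n} {I : Pred₀ m} {J : Pred₀ n} → I ≅ J → J ↪ I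
≅⇒↩ {m} {n} {I} {J} (φ , (φ-injective , φ-surjective) , I⇔J) = embedding φ⁻¹ φ⁻¹-injective J⇔I
  where
  φ⁻¹ : Fin n → Fin m
  φ⁻¹ y = proj₁ (φ-surjective y)
  φ∘φ⁻¹ : ∀ y → φ (φ⁻¹ y) ≡ y
  φ∘φ⁻¹ y = proj₂ (φ-surjective y) refl
  φ⁻¹-injective : Injective _≡_ _≡_ φ⁻¹
  φ⁻¹-injective {y} {y′} eq = trans (sym (φ∘φ⁻¹ y)) (trans (cong φ eq) (φ∘φ⁻¹ y′))
  φ[φ⁻¹[Z]] : ∀ Z → image φ (image φ⁻¹ Z) ≡ Z
  φ[φ⁻¹[Z]] Z = begin
    image φ (image φ⁻¹ Z) ≡⟨ image-∘ φ φ⁻¹ Z ⟨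
    image (φ ∘ φ⁻¹) Z     ≡⟨ image-cong φ∘φ⁻¹ Z ⟩
    image id Z            ≡⟨ image-id Z ⟩
    Z                     ∎
    where open ≡-Reasoning
  J⇔I : ∀ Z → J Z ⇔ I (image φ⁻¹ Z)
  J⇔I Z = ⇔-sym (subst (λ W → I (image φ⁻¹ Z) ⇔ J W) (φ[φ⁻¹[Z]] Z) (I⇔J (image φ⁻¹ Z)))

⇔⇒↪ : ∀ {n} {I J : Pred₀ n} → (∀ X → I X ⇔ J X) → I ↪ J
⇔⇒↪ {I = I} {J} I⇔J = embedding id id λ X → subst (λ W → I X ⇔ J W) (sym (image-id X)) (I⇔J X)

↪-trans : ∀ {l m n} {I : Pred₀ l} {J : Pred₀ m} {K : Pred₀ n} → I ↪ J → J ↪ K → I ↪ K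
↪-trans {K = K} (embedding f f-injective I⇔J) (embedding g g-injective J⇔K) =
  embedding (g ∘ f) (f-injective ∘ g-injective) λ X →
    ⇔-trans (I⇔J X) (subst (λ W → _ ⇔ K W) (sym (image-∘ g f X)) (J⇔K (image f X)))

-- A minor M / C \ D of M written with C independent, so that M / C is simply Y ↦ M (Y ∪ C);
-- every minor has this form.
record Minor {m n} (I : Pred₀ m) (J : Pred₀ n) : Set where
  field
    embed                  : Fin m → Fin n
    embed-injective        : Injective _≡_ _≡_ embed
    contracted             : Subset n
    embed∉contracted       : ∀ x → embed x ∉ contracted
    contracted-independent : J contracted
    independent⇔           : ∀ X → I X ⇔ J (image embed X ∪ contracted)

module _ {k l m n} {I : Pred₀ k} {I′ : Pred₀ l} {J′ : Pred₀ m} {J : Pred₀ n} where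

  Minor-↪ : I ↪ I′ → Minor I′ J′ → J′ ↪ J → Minor I J
  Minor-↪ (embedding f f-injective I⇔I′) μ (embedding g g-injective J′⇔J) = record
    { embed                  = g ∘ embed ∘ f
    ; embed-injective        = f-injective ∘ embed-injective ∘ g-injective
    ; contracted             = image g contracted
    ; embed∉contracted       = embed∉contracted′
    ; contracted-independent = Equivalence.to (J′⇔J contracted) contracted-independent
    ; independent⇔           = independent⇔′
    }
    where
    open Minor μ
    embed∉contracted′ : ∀ x → g (embed (f x)) ∉ image g contracted
    embed∉contracted′ x g[x]∈ = let c , c∈C , gc≡ = ∈-image⁻ g g[x]∈ in
      embed∉contracted (f x) (subst (_∈ contracted) (g-injective gc≡) c∈C)
    image-g∘embed∘f : ∀ X → image (g ∘ embed ∘ f) X ≡ image g (image embed (image f X))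
    image-g∘embed∘f X = trans (image-∘ g (embed ∘ f) X) (cong (image g) (image-∘ embed f X))
    independent⇔′ : ∀ X → I X ⇔ J (image (g ∘ embed ∘ f) X ∪ image g contracted)
    independent⇔′ X = begin
      I X
        ∼⟨ I⇔I′ X ⟩
      I′ (image f X)
        ∼⟨ independent⇔ (image f X) ⟩
      J′ (image embed (image f X) ∪ contracted)
        ∼⟨ J′⇔J _ ⟩
      J (image g (image embed (image f X) ∪ contracted))
        ≡⟨ cong J (image-∪ g _ contracted) ⟩
      J (image g (image embed (image f X)) ∪ image g contracted)
        ≡⟨ cong (λ W → J (W ∪ _)) (image-g∘embed∘f X) ⟨
      J (image (g ∘ embed ∘ f) X ∪ image g contracted)
        ∎
      where open Related.EquationalReasoning

IndepContr⇔ : ∀ {n} (M : Matroid n) {C} → Indep M C → ∀ Y → IndepContr M C Y ⇔ Indep M (Y ∪ C)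
IndepContr⇔ M {C} iC Y = mk⇔ to from
  where
  to : IndepContr M C Y → Indep M (Y ∪ C)
  to (B , (B⊆C , _ , maximal) , iY∪B) =
    subst (λ B → Indep M (Y ∪ B)) (sym (maximal C B⊆C ⊆-refl iC)) iY∪B
  C-basis-of-C : IsBasisOf (Indep M) C C
  C-basis-of-C = ⊆-refl , iC , λ Z C⊆Z Z⊆C _ → ⊆-antisym Z⊆C C⊆Z
  from : Indep M (Y ∪ C) → IndepContr M C Y
  from iY∪C = C , C-basis-of-C , iY∪C

Minor⇒≼ : ∀ {m n} (M : Matroid m) (N : Matroid n) → Minor (Indep M) (Indep N) → M ≼ N
Minor⇒≼ M N μ = embed , embed-injective , contracted , embed∉contracted ,
  λ X → ⇔-trans (independent⇔ X) (⇔-sym (IndepContr⇔ N contracted-independent (image embed X)))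
  where open Minor μ

module _ {m n} {I : Pred₀ m} {J : Pred₀ n} (μ : Minor I J) where
  open Minor μ

  Minor-skip : ∀ b {J′ : Pred₀ (suc n)} → (∀ Z → J Z ⇔ J′ (b ∷ Z)) → Minor I J′
  Minor-skip b {J′} J⇔J′ = record
    { embed                  = suc ∘ embed
    ; embed-injective        = embed-injective ∘ suc-injective
    ; contracted             = b ∷ contracted
    ; embed∉contracted       = λ x → embed∉contracted x ∘ drop-there
    ; contracted-independent = Equivalence.to (J⇔J′ contracted) contracted-independent
    ; independent⇔           = λ X → subst (λ W → I X ⇔ J′ W) (sym (image-suc-∪ embed b X contracted))
                                        (⇔-trans (independent⇔ X) (J⇔J′ _))
    }

  Minor-lift : ∀ {I′ : Pred₀ (suc m)} {J′ : Pred₀ (suc n)} → J′ (outside ∷ contracted) →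
               (∀ b X → I′ (b ∷ X) ⇔ J′ (b ∷ (image embed X ∪ contracted))) → Minor I′ J′
  Minor-lift {I′} {J′} iC fibre⇔ = record
    { embed                  = lift 1 embed
    ; embed-injective        = lift-injective embed embed-injective 1
    ; contracted             = outside ∷ contracted
    ; embed∉contracted       = λ { zero () ; (suc x) → embed∉contracted x ∘ drop-there }
    ; contracted-independent = iC
    ; independent⇔           = λ { (b ∷ X) → subst (λ W → I′ (b ∷ X) ⇔ J′ W)
                                                 (sym (image-lift-∪ embed b X contracted)) (fibre⇔ b X) }
    }

-- Minors of nested matroids from embeddings of construction words

-- The size bookkeeping makes ∣ X ∣ < rank e₁ equivalent to
-- ∣ image embed X ∪ contracted ∣ < rank e₂, which is what a matched free-extension element needs.
record NestedMinor {m n} (e₁ : NestedExpr m) (e₂ : NestedExpr n) : Set where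
  field
    minor : Minor (Independent e₁) (Independent e₂)
  open Minor minor public
  field
    rank-≡ : rank e₂ ≡ rank e₁ + ∣ contracted ∣
    ∣∣-≡   : ∀ X → ∣ image embed X ∪ contracted ∣ ≡ ∣ X ∣ + ∣ contracted ∣

spine : ∀ {n} → NestedExpr n → Subset n
spine empty       = []
spine (isthmus e) = inside ∷ spine e
spine (freeExt e) = outside ∷ spine e

spine-independent : ∀ {n} (e : NestedExpr n) → Independent e (spine e)
spine-independent empty       = tt
spine-independent (isthmus e) = spine-independent e
spine-independent (freeExt e) = spine-independent e

∣spine∣≡rank : ∀ {n} (e : NestedExpr n) → ∣ spine e ∣ ≡ rank e
∣spine∣≡rank empty       = refl
∣spine∣≡rank (isthmus e) = cong suc (∣spine∣≡rank e)
∣spine∣≡rank (freeExt e) = ∣spine∣≡rank e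

empty-NestedMinor : ∀ {n} (e : NestedExpr n) → NestedMinor empty e
empty-NestedMinor e = record
  { minor = record
    { embed                  = λ ()
    ; embed-injective        = λ { {()} }
    ; contracted             = spine e
    ; embed∉contracted       = λ ()
    ; contracted-independent = spine-independent e
    ; independent⇔           = λ { [] → mk⇔ (λ _ → spine∪-independent) _ }
    }
  ; rank-≡ = sym (∣spine∣≡rank e)
  ; ∣∣-≡   = λ { [] → cong ∣_∣ (∪-identityˡ (spine e)) }
  }
  where
  spine∪-independent : Independent e (⊥ ∪ spine e)
  spine∪-independent = subst (Independent e) (sym (∪-identityˡ (spine e))) (spine-independent e)

module _ {m n} {e₁ : NestedExpr m} {e₂ : NestedExpr n} (μ : NestedMinor e₁ e₂) where
  open NestedMinor μ

  contract-isthmus : NestedMinor e₁ (isthmus e₂)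
  contract-isthmus = record
    { minor  = Minor-skip minor inside (λ _ → ⇔-refl)
    ; rank-≡ = trans (cong suc rank-≡) (sym (+-suc _ _))
    ; ∣∣-≡   = λ X → trans (cong ∣_∣ (image-suc-∪ embed inside X contracted))
                           (trans (cong suc (∣∣-≡ X)) (sym (+-suc _ _)))
    }

  delete-freeExt : NestedMinor e₁ (freeExt e₂)
  delete-freeExt = record
    { minor  = Minor-skip minor outside (λ _ → ⇔-refl)
    ; rank-≡ = rank-≡
    ; ∣∣-≡   = λ X → trans (cong ∣_∣ (image-suc-∪ embed outside X contracted)) (∣∣-≡ X)
    }

  ∣∣-≡-lift : ∀ X → ∣ image (lift 1 embed) X ∪ (outside ∷ contracted) ∣ ≡ ∣ X ∣ + ∣ contracted ∣
  ∣∣-≡-lift (inside ∷ X)  =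
    trans (cong ∣_∣ (image-lift-∪ embed inside X contracted)) (cong suc (∣∣-≡ X))
  ∣∣-≡-lift (outside ∷ X) = trans (cong ∣_∣ (image-lift-∪ embed outside X contracted)) (∣∣-≡ X)

  keep-isthmus : NestedMinor (isthmus e₁) (isthmus e₂)
  keep-isthmus = record
    { minor  = Minor-lift minor contracted-independent (λ _ → independent⇔)
    ; rank-≡ = cong suc rank-≡
    ; ∣∣-≡   = ∣∣-≡-lift
    }

  below-rank⇔ : ∀ X → ∣ X ∣ < rank e₁ ⇔ ∣ image embed X ∪ contracted ∣ < rank e₂
  below-rank⇔ X rewrite ∣∣-≡ X | rank-≡ = mk⇔ (+-monoˡ-< ∣ contracted ∣) (+-cancelʳ-< _ _ _)

  keep-freeExt : NestedMinor (freeExt e₁) (freeExt e₂)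
  keep-freeExt = record
    { minor  = Minor-lift minor contracted-independent fibre⇔
    ; rank-≡ = rank-≡
    ; ∣∣-≡   = ∣∣-≡-lift
    }
    where
    fibre⇔ : ∀ b X → Independent (freeExt e₁) (b ∷ X) ⇔
                     Independent (freeExt e₂) (b ∷ (image embed X ∪ contracted))
    fibre⇔ outside X = independent⇔ X
    fibre⇔ inside  X = independent⇔ X ×-⇔ below-rank⇔ X

word : ∀ {n} → NestedExpr n → Word
word empty       = []
word (isthmus e) = true ∷ word e
word (freeExt e) = false ∷ word e

⊑⇒NestedMinor : ∀ {m n} (e₁ : NestedExpr m) (e₂ : NestedExpr n) →
                word e₁ ⊑ word e₂ → NestedMinor e₁ e₂
⊑⇒NestedMinor empty        e₂           _            = empty-NestedMinor e₂
⊑⇒NestedMinor e₁           (isthmus e₂) (_ ∷ʳ w⊑w)   = contract-isthmus (⊑⇒NestedMinor e₁ e₂ w⊑w)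
⊑⇒NestedMinor e₁           (freeExt e₂) (_ ∷ʳ w⊑w)   = delete-freeExt (⊑⇒NestedMinor e₁ e₂ w⊑w)
⊑⇒NestedMinor (isthmus e₁) (isthmus e₂) (refl ∷ w⊑w) = keep-isthmus (⊑⇒NestedMinor e₁ e₂ w⊑w)
⊑⇒NestedMinor (freeExt e₁) (freeExt e₂) (refl ∷ w⊑w) = keep-freeExt (⊑⇒NestedMinor e₁ e₂ w⊑w)

nestedWord : NestedMatroid → Word
nestedWord (_ , _ , e , _) = word e

nestedWord-⊑⇒≼ⁿ : ∀ M N → nestedWord M ⊑ nestedWord N → M ≼ⁿ N
nestedWord-⊑⇒≼ⁿ (_ , M , e₁ , M≅e₁) (_ , N , e₂ , N≅e₂) w⊑w =
  Minor⇒≼ M N (Minor-↪ M↪e₁ (NestedMinor.minor (⊑⇒NestedMinor e₁ e₂ w⊑w)) e₂↪N)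
  where
  M↪e₁ : Indep M ↪ Independent e₁
  M↪e₁ = ↪-trans {J = ⟦ e₁ ⟧} (≅⇒↪ M≅e₁) (⇔⇒↪ (⟦⟧⇔Independent e₁))
  e₂↪N : Independent e₂ ↪ Indep N
  e₂↪N = ↪-trans {J = ⟦ e₂ ⟧} (⇔⇒↪ (⇔-sym ∘ ⟦⟧⇔Independent e₂)) (≅⇒↩ N≅e₂)

theorem5p4 : (f : ℕ → NestedMatroid) → ∃[ i ] ∃[ j ] (i < j × f i ≼ⁿ f j)
theorem5p4 f =
  let i , j , i<j , w⊑w = higman (nestedWord ∘ f)
  in  i , j , i<j , nestedWord-⊑⇒≼ⁿ (f i) (f j) w⊑w
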